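{- Let $a_{n,k}$ denote the number of matchings of size $n$ with exactly $k$ occurrences of the endhered pattern $21$. For all integers $n>k\ge 0$, $$a_{n,k}=\binom{n-1}{k}\,a_{n-k,0}.$$
   Context: A (perfect) matching of size $n$ is a partition of $\{1,\dots,2n\}$ into $n$ two-element sets called arcs. An occurrence of the endhered pattern $21$ in a matching $\mu$ of size $n$ is a pair of integers $(i,j)$ with $i\ge0$, $i+2\le j$, $j+2\le 2n$, such that $\{i+1,j+2\}$ and $\{i+2,j+1\}$ are both arcs of $\mu$; the number of occurrences is the number of such pairs. -}

module Defs where

open import Data.Nat using (ℕ; zero; suc; _+_; _*_; _≡ᵇ_; _<ᵇ_)
open import Data.Bool using (Bool; true; false; _∧_; not; if_then_else_)
open import Data.Fin using (Fin; toℕ)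
open import Data.Vec using (Vec; []; _∷_; lookup)
open import Data.List using (List; []; _∷_; [_]; map; concatMap; allFin; filter; length; upTo)
open import Data.Bool.ListAction using (and)
open import Data.Nat.ListAction using (sum)
open import Relation.Nullary.Decidable using (T?)
open import Data.Bool using (T)

allVecs : (m k : ℕ) → List (Vec (Fin k) m)
allVecs zero    k = [ [] ]
allVecs (suc m) k = concatMap (λ x → map (x ∷_) (allVecs m k)) (allFin k)

-- A perfect matching on {0,…,m-1} (0-based; position p corresponds to p+1)
-- is encoded as its partner function v : a fixed-point-free involution.
isMatching : {m : ℕ} → Vec (Fin m) m → Bool
isMatching {m} v =
  and (map (λ i → (toℕ (lookup v (lookup v i)) ≡ᵇ toℕ i) ∧ not (toℕ (lookup v i) ≡ᵇ toℕ i))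
           (allFin m))

-- partner of position p (as a natural number); p is always in range below
at : {k m : ℕ} → Vec (Fin k) m → ℕ → ℕ
at []      _       = 0
at (x ∷ v) zero    = toℕ x
at (x ∷ v) (suc p) = at v p

-- Occurrences of the endhered pattern 21 in a matching of size n:
-- pairs (i , j) with i ≥ 0, i + 2 ≤ j, j + 2 ≤ 2n such that
-- {i+1, j+2} and {i+2, j+1} are arcs (1-based), i.e. in 0-based positions
-- partner(i) = j+1 and partner(i+1) = j.
occ21 : (n : ℕ) → Vec (Fin (2 * n)) (2 * n) → ℕ
occ21 n v =
  sum (map (λ i → sum (map (λ j →
         if (i + 2 <ᵇ j + 1) ∧ (j + 2 <ᵇ 2 * n + 1)
              ∧ (at v i ≡ᵇ j + 1) ∧ (at v (i + 1) ≡ᵇ j)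
         then 1 else 0)
       (upTo (2 * n))))
     (upTo (2 * n)))

a : ℕ → ℕ → ℕ
a n k = length (filter (λ v → T? (isMatching v ∧ (occ21 n v ≡ᵇ k)))
                       (allVecs (2 * n) (2 * n)))

-- Deleting the inner arc of a marked occurrence of 21 in a matching of size n + 1 with k + 1
-- occurrences leaves a matching of size n with k occurrences and a marked arc (the former outer
-- arc); conversely, nesting a new arc immediately inside any arc creates exactly one occurrence
-- and destroys none.  Counting the marked objects both ways gives
-- (k + 1) a(n + 1, k + 1) = n a(n, k), and induction on k with the absorption identity
-- (k + 1) C(n, k + 1) = n C(n - 1, k) gives the formula.
module Submission where

open import Data.Bool using (Bool; true; false; T; if_then_else_; _∧_)
open import Data.Empty using (⊥-elim)
open import Data.Fin as Fin using (Fin; zero; suc; toℕ; fromℕ<)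
import Data.Fin.Properties as Fin
open import Data.List
  using (List; []; _∷_; _++_; map; concatMap; cartesianProductWith; cartesianProduct; upTo; allFin; filter; length; tabulate)
open import Data.List.Properties using (map-tabulate; map-++; map-∘; upTo-∷ʳ)
import Data.List.Relation.Unary.All.Properties as All
open import Data.Nat
open import Data.Nat.Combinatorics using (_C_; nC1≡n; nCk+nC[k+1]≡[n+1]C[k+1])
open import Data.Nat.DivMod using (_mod_; _%_; m<n⇒m%n≡m)
open import Data.Nat.ListAction using (sum)
open import Data.Nat.ListAction.Properties using (sum-++)
open import Data.Nat.Properties
import Algebra.Properties.CommutativeSemigroup +-commutativeSemigroup as +-CS
import Algebra.Properties.CommutativeSemigroup *-commutativeSemigroup as *-CS
open import Data.Product using (_×_; _,_; proj₁; proj₂)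
import Data.Product.Properties as Product
open import Data.Sum using (inj₁; inj₂)
open import Data.Vec using (Vec; []; _∷_; lookup)
import Data.Vec as Vec using (tabulate)
import Data.Vec.Properties as Vec
open import Function using (_∘_; id)
open import Relation.Binary.Definitions using (DecidableEquality; tri<; tri≈; tri>)
open import Relation.Binary.PropositionalEquality
open import Relation.Nullary using (Dec; yes; no; ¬_; does; _×-dec_)
open import Relation.Nullary.Decidable using (T?; ¬?; toWitness; fromWitness; isYes≗does)
open import Defs

private
  variable
    A B D : Set
    P Q : Set

χ : Bool → ℕ
χ b = if b then 1 else 0

𝟙 : Dec P → ℕ
𝟙 p? = χ (does p?)

𝟙-yes : (p? : Dec P) → P → 𝟙 p? ≡ 1
𝟙-yes (yes _) _ = refl
𝟙-yes (no ¬p) p = ⊥-elim (¬p p)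

𝟙-no : (p? : Dec P) → ¬ P → 𝟙 p? ≡ 0
𝟙-no (yes p) ¬p = ⊥-elim (¬p p)
𝟙-no (no _)  _  = refl

𝟙≢0⇒ : (p? : Dec P) → 𝟙 p? ≢ 0 → P
𝟙≢0⇒ (yes p) _  = p
𝟙≢0⇒ (no _)  ne = ⊥-elim (ne refl)

𝟙-cong : (p? : Dec P) (q? : Dec Q) → (P → Q) → (Q → P) → 𝟙 p? ≡ 𝟙 q?
𝟙-cong (yes _) (yes _) _   _   = refl
𝟙-cong (yes p) (no ¬q) p→q _   = ⊥-elim (¬q (p→q p))
𝟙-cong (no ¬p) (yes q) _   q→p = ⊥-elim (¬p (q→p q))
𝟙-cong (no _)  (no _)  _   _   = refl

χ-∧ : ∀ b c → χ (b ∧ c) ≡ χ b * χ c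
χ-∧ false c = refl
χ-∧ true  c = sym (+-identityʳ (χ c))

𝟙-× : (p? : Dec P) (q? : Dec Q) → 𝟙 (p? ×-dec q?) ≡ 𝟙 p? * 𝟙 q?
𝟙-× p? q? = χ-∧ (does p?) (does q?)

𝟙*≢0⇒ : ∀ (p? : Dec P) w → 𝟙 p? * w ≢ 0 → P
𝟙*≢0⇒ (yes p) _ _  = p
𝟙*≢0⇒ (no _)  _ ne = ⊥-elim (ne refl)

𝟙-*-cong : ∀ {m n} (p? : Dec P) → (P → m ≡ n) → 𝟙 p? * m ≡ 𝟙 p? * n
𝟙-*-cong (yes p) m≡n = cong (1 *_) (m≡n p)
𝟙-*-cong (no _)  _   = refl

if-yes : ∀ {x y : A} (p? : Dec P) → P → (if does p? then x else y) ≡ x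
if-yes (yes _) _ = refl
if-yes (no ¬p) p = ⊥-elim (¬p p)

if-no : ∀ {x y : A} (p? : Dec P) → ¬ P → (if does p? then x else y) ≡ y
if-no (yes p) ¬p = ⊥-elim (¬p p)
if-no (no _)  _  = refl

punchIn : ℕ → ℕ → ℕ
punchIn a x = if does (x <? a) then x else suc x

punchOut : ℕ → ℕ → ℕ
punchOut a y = if does (y <? a) then y else pred y

punchIn-< : ∀ {a x} → x < a → punchIn a x ≡ x
punchIn-< {a} {x} x<a = if-yes (x <? a) x<a

punchIn-≥ : ∀ {a x} → a ≤ x → punchIn a x ≡ suc x
punchIn-≥ {a} {x} a≤x = if-no (x <? a) (≤⇒≯ a≤x)

punchOut-< : ∀ {a y} → y < a → punchOut a y ≡ y
punchOut-< {a} {y} y<a = if-yes (y <? a) y<a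

punchOut-≥ : ∀ {a y} → a ≤ y → punchOut a y ≡ pred y
punchOut-≥ {a} {y} a≤y = if-no (y <? a) (≤⇒≯ a≤y)

punchOut-punchIn : ∀ a x → punchOut a (punchIn a x) ≡ x
punchOut-punchIn a x with x <? a
... | yes x<a = trans (cong (punchOut a) (punchIn-< x<a)) (punchOut-< x<a)
... | no  x≮a = trans (cong (punchOut a) (punchIn-≥ (≮⇒≥ x≮a))) (punchOut-≥ (m≤n⇒m≤1+n (≮⇒≥ x≮a)))

punchIn-punchOut : ∀ {a y} → y ≢ a → punchIn a (punchOut a y) ≡ y
punchIn-punchOut {a} {y} y≢a with y <? a
... | yes y<a = trans (cong (punchIn a) (punchOut-< y<a)) (punchIn-< y<a)
punchIn-punchOut {a} {zero}  y≢a | no y≮a = ⊥-elim (y≢a (sym (n≤0⇒n≡0 (≮⇒≥ y≮a))))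
punchIn-punchOut {a} {suc y} y≢a | no y≮a =
  trans (cong (punchIn a) (punchOut-≥ (≮⇒≥ y≮a))) (punchIn-≥ (s≤s⁻¹ (≤∧≢⇒< (≮⇒≥ y≮a) (y≢a ∘ sym))))

punchInᵢ≢i : ∀ a x → punchIn a x ≢ a
punchInᵢ≢i a x with x <? a
... | yes x<a = λ e → <-irrefl (trans (sym (punchIn-< x<a)) e) x<a
... | no  x≮a = λ e → 1+n≰n (subst (_≤ x) (trans (sym e) (punchIn-≥ (≮⇒≥ x≮a))) (≮⇒≥ x≮a))

≤-punchIn : ∀ a x → x ≤ punchIn a x
≤-punchIn a x with x <? a
... | yes x<a = ≤-reflexive (sym (punchIn-< x<a))
... | no  x≮a = ≤-trans (n≤1+n x) (≤-reflexive (sym (punchIn-≥ (≮⇒≥ x≮a))))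

punchIn-≤ : ∀ a x → punchIn a x ≤ suc x
punchIn-≤ a x with x <? a
... | yes x<a = ≤-trans (≤-reflexive (punchIn-< x<a)) (n≤1+n x)
... | no  x≮a = ≤-reflexive (punchIn-≥ (≮⇒≥ x≮a))

punchIn-mono-< : ∀ a {x y} → x < y → punchIn a x < punchIn a y
punchIn-mono-< a {x} {y} x<y with x <? a | y <? a
... | yes x<a | yes y<a = subst₂ _<_ (sym (punchIn-< x<a)) (sym (punchIn-< y<a)) x<y
... | yes x<a | no  y≮a = subst₂ _<_ (sym (punchIn-< x<a)) (sym (punchIn-≥ (≮⇒≥ y≮a))) (m<n⇒m<1+n x<y)
... | no  x≮a | yes y<a = ⊥-elim (x≮a (<-trans x<y y<a))
... | no  x≮a | no  y≮a = subst₂ _<_ (sym (punchIn-≥ (≮⇒≥ x≮a))) (sym (punchIn-≥ (≮⇒≥ y≮a))) (s<s x<y)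

∑< : ℕ → (ℕ → ℕ) → ℕ
∑< zero    F = 0
∑< (suc N) F = ∑< N F + F N

syntax ∑< N (λ i → e) = ∑[ i < N ] e

∑<-cong : ∀ N {F G : ℕ → ℕ} → (∀ x → x < N → F x ≡ G x) → ∑< N F ≡ ∑< N G
∑<-cong zero    _   = refl
∑<-cong (suc N) F≗G = cong₂ _+_ (∑<-cong N (λ x x<N → F≗G x (m<n⇒m<1+n x<N))) (F≗G N ≤-refl)

∑<-zero : ∀ N {F : ℕ → ℕ} → (∀ x → x < N → F x ≡ 0) → ∑< N F ≡ 0
∑<-zero zero    _  = refl
∑<-zero (suc N) F≗0 = cong₂ _+_ (∑<-zero N (λ x x<N → F≗0 x (m<n⇒m<1+n x<N))) (F≗0 N ≤-refl)

∑<-single : ∀ N {y} {F : ℕ → ℕ} → y < N → (∀ x → x < N → x ≢ y → F x ≡ 0) → ∑< N F ≡ F y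
∑<-single (suc N) {y} {F} y<1+N F≗0 with y ≟ N
... | yes refl = cong (_+ F y) (∑<-zero N (λ x x<N → F≗0 x (m<n⇒m<1+n x<N) (<⇒≢ x<N)))
... | no  y≢N  = begin
  ∑< N F + F N ≡⟨ cong₂ _+_ (∑<-single N y<N (λ x x<N → F≗0 x (m<n⇒m<1+n x<N))) (F≗0 N ≤-refl (y≢N ∘ sym)) ⟩
  F y + 0      ≡⟨ +-identityʳ (F y) ⟩
  F y          ∎
  where
    open ≡-Reasoning
    y<N = ≤∧≢⇒< (s≤s⁻¹ y<1+N) y≢N

∑<-+ : ∀ N (F G : ℕ → ℕ) → ∑[ x < N ] (F x + G x) ≡ ∑< N F + ∑< N G
∑<-+ zero    F G = refl
∑<-+ (suc N) F G = trans (cong (_+ (F N + G N)) (∑<-+ N F G)) (+-CS.interchange (∑< N F) (∑< N G) (F N) (G N))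

∑<-const-1 : ∀ N → ∑[ x < N ] 1 ≡ N
∑<-const-1 zero    = refl
∑<-const-1 (suc N) = trans (cong (_+ 1) (∑<-const-1 N)) (+-comm N 1)

∑<-punchIn : ∀ N {a} (F : ℕ → ℕ) → a ≤ N → ∑< (suc N) F ≡ ∑[ x < N ] F (punchIn a x) + F a
∑<-punchIn N {a} F a≤N with m≤n⇒m<n∨m≡n a≤N
... | inj₂ refl = cong (_+ F N) (∑<-cong N (λ x x<N → cong F (sym (punchIn-< x<N))))
∑<-punchIn (suc N) {a} F _ | inj₁ a<1+N = begin
  ∑< (suc N) F + F (suc N)                      ≡⟨ cong (_+ F (suc N)) (∑<-punchIn N F a≤N) ⟩
  ∑[ x < N ] F (punchIn a x) + F a + F (suc N)  ≡⟨ +-CS.xy∙z≈xz∙y _ (F a) (F (suc N)) ⟩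
  ∑[ x < N ] F (punchIn a x) + F (suc N) + F a  ≡⟨ cong (λ z → ∑[ x < N ] F (punchIn a x) + F z + F a) (punchIn-≥ a≤N) ⟨
  ∑[ x < suc N ] F (punchIn a x) + F a          ∎
  where
    open ≡-Reasoning
    a≤N = s≤s⁻¹ a<1+N

∑<-exchange : ∀ N {p} {F G : ℕ → ℕ} → p < N → (∀ x → x < N → x ≢ p → F x ≡ G x) →
              ∑< N F + G p ≡ ∑< N G + F p
∑<-exchange (suc N) {p} {F} {G} p<1+N F≗G = begin
  ∑< (suc N) F + G p                          ≡⟨ cong (_+ G p) (∑<-punchIn N F p≤N) ⟩
  ∑[ x < N ] F (punchIn p x) + F p + G p      ≡⟨ cong (λ z → z + F p + G p) (∑<-cong N agree) ⟩
  ∑[ x < N ] G (punchIn p x) + F p + G p      ≡⟨ +-CS.xy∙z≈xz∙y _ (F p) (G p) ⟩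
  ∑[ x < N ] G (punchIn p x) + G p + F p      ≡⟨ cong (_+ F p) (∑<-punchIn N G p≤N) ⟨
  ∑< (suc N) G + F p                          ∎
  where
    open ≡-Reasoning
    p≤N = s≤s⁻¹ p<1+N
    agree : ∀ x → x < N → F (punchIn p x) ≡ G (punchIn p x)
    agree x x<N = F≗G _ (s≤s (≤-trans (punchIn-≤ p x) x<N)) (punchInᵢ≢i p x)

∑∈ : List A → (A → ℕ) → ℕ
∑∈ xs f = sum (map f xs)

syntax ∑∈ xs (λ x → e) = ∑[ x ∈ xs ] e

∑∈-cong : ∀ (xs : List A) {f g : A → ℕ} → (∀ x → f x ≡ g x) → ∑∈ xs f ≡ ∑∈ xs g
∑∈-cong []       _   = refl
∑∈-cong (x ∷ xs) f≗g = cong₂ _+_ (f≗g x) (∑∈-cong xs f≗g)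

∑∈-++ : ∀ (xs ys : List A) (f : A → ℕ) → ∑∈ (xs ++ ys) f ≡ ∑∈ xs f + ∑∈ ys f
∑∈-++ xs ys f = trans (cong sum (map-++ f xs ys)) (sum-++ (map f xs) (map f ys))

∑∈-map : ∀ (g : A → B) (xs : List A) (f : B → ℕ) → ∑∈ (map g xs) f ≡ ∑[ x ∈ xs ] f (g x)
∑∈-map g xs f = cong sum (sym (map-∘ xs))

∑∈-cartesianProductWith : ∀ (h : A → B → D) (xs : List A) (ys : List B) (f : D → ℕ) →
                          ∑∈ (cartesianProductWith h xs ys) f ≡ ∑[ x ∈ xs ] ∑[ y ∈ ys ] f (h x y)
∑∈-cartesianProductWith h []       ys f = refl
∑∈-cartesianProductWith h (x ∷ xs) ys f = begin
  ∑∈ (map (h x) ys ++ cartesianProductWith h xs ys) f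
    ≡⟨ ∑∈-++ (map (h x) ys) _ f ⟩
  ∑∈ (map (h x) ys) f + ∑∈ (cartesianProductWith h xs ys) f
    ≡⟨ cong₂ _+_ (∑∈-map (h x) ys f) (∑∈-cartesianProductWith h xs ys f) ⟩
  ∑[ y ∈ ys ] f (h x y) + ∑[ x′ ∈ xs ] ∑[ y ∈ ys ] f (h x′ y) ∎
  where open ≡-Reasoning

∑∈-*ˡ : ∀ (xs : List A) (f : A → ℕ) c → ∑[ x ∈ xs ] (c * f x) ≡ c * ∑∈ xs f
∑∈-*ˡ []       f c = sym (*-zeroʳ c)
∑∈-*ˡ (x ∷ xs) f c = trans (cong (c * f x +_) (∑∈-*ˡ xs f c)) (sym (*-distribˡ-+ c (f x) _))

∑∈-*ʳ : ∀ (xs : List A) (f : A → ℕ) c → ∑[ x ∈ xs ] (f x * c) ≡ ∑∈ xs f * c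
∑∈-*ʳ []       f c = refl
∑∈-*ʳ (x ∷ xs) f c = trans (cong (f x * c +_) (∑∈-*ʳ xs f c)) (sym (*-distribʳ-+ c (f x) _))

∑∈-const-0 : ∀ (xs : List A) → ∑[ x ∈ xs ] 0 ≡ 0
∑∈-const-0 []       = refl
∑∈-const-0 (x ∷ xs) = ∑∈-const-0 xs

∑∈-+ : ∀ (xs : List A) (f g : A → ℕ) → ∑[ x ∈ xs ] (f x + g x) ≡ ∑∈ xs f + ∑∈ xs g
∑∈-+ []       f g = refl
∑∈-+ (x ∷ xs) f g = trans (cong (f x + g x +_) (∑∈-+ xs f g)) (+-CS.interchange (f x) (g x) _ _)

∑∈-comm : ∀ (xs : List A) (ys : List B) (F : A → B → ℕ) →
          ∑[ x ∈ xs ] ∑[ y ∈ ys ] F x y ≡ ∑[ y ∈ ys ] ∑[ x ∈ xs ] F x y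
∑∈-comm []       ys F = sym (∑∈-const-0 ys)
∑∈-comm (x ∷ xs) ys F =
  trans (cong (∑∈ ys (F x) +_) (∑∈-comm xs ys F)) (sym (∑∈-+ ys (F x) (λ y → ∑[ x′ ∈ xs ] F x′ y)))

∑∈-upTo : ∀ N (F : ℕ → ℕ) → ∑∈ (upTo N) F ≡ ∑< N F
∑∈-upTo zero    F = refl
∑∈-upTo (suc N) F = begin
  ∑∈ (upTo (suc N)) F          ≡⟨ cong (λ xs → ∑∈ xs F) (upTo-∷ʳ N) ⟨
  ∑∈ (upTo N ++ N ∷ []) F      ≡⟨ ∑∈-++ (upTo N) (N ∷ []) F ⟩
  ∑∈ (upTo N) F + (F N + 0)    ≡⟨ cong₂ _+_ (∑∈-upTo N F) (+-identityʳ (F N)) ⟩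
  ∑< N F + F N                 ∎
  where open ≡-Reasoning

length-filter-T? : ∀ (b : A → Bool) (xs : List A) → length (filter (λ x → T? (b x)) xs) ≡ ∑[ x ∈ xs ] χ (b x)
length-filter-T? b []       = refl
length-filter-T? b (x ∷ xs) with b x
... | true  = cong suc (length-filter-T? b xs)
... | false = length-filter-T? b xs

multiplicity : DecidableEquality A → A → List A → ℕ
multiplicity _≟_ a xs = ∑[ x ∈ xs ] 𝟙 (a ≟ x)

module _ (_≟ᴬ_ : DecidableEquality A) (_≟ᴮ_ : DecidableEquality B)
         (xs : List A) (ys : List B) {g : A → ℕ} {h : B → ℕ} (φ : A → B) (ψ : B → A) where

  -- Summing over the pairs (x , y) with φ x ≡ y, equivalently ψ y ≡ x, in both orders.
  ∑∈-reindex : (∀ x → g x ≢ 0 → multiplicity _≟ᴮ_ (φ x) ys ≡ 1 × ψ (φ x) ≡ x × h (φ x) ≡ g x) →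
               (∀ y → h y ≢ 0 → multiplicity _≟ᴬ_ (ψ y) xs ≡ 1 × φ (ψ y) ≡ y × g (ψ y) ≡ h y) →
               ∑∈ xs g ≡ ∑∈ ys h
  ∑∈-reindex φ-ok ψ-ok = begin
    ∑∈ xs g                                               ≡⟨ ∑∈-cong xs spread ⟨
    ∑[ x ∈ xs ] ∑[ y ∈ ys ] (𝟙 (φ x ≟ᴮ y) * g x)          ≡⟨ ∑∈-comm xs ys _ ⟩
    ∑[ y ∈ ys ] ∑[ x ∈ xs ] (𝟙 (φ x ≟ᴮ y) * g x)          ≡⟨ ∑∈-cong ys (λ y → ∑∈-cong xs (λ x → linked x y)) ⟩
    ∑[ y ∈ ys ] ∑[ x ∈ xs ] (𝟙 (ψ y ≟ᴬ x) * h y)          ≡⟨ ∑∈-cong ys spread′ ⟩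
    ∑∈ ys h                                               ∎
    where
      open ≡-Reasoning

      trivial-weight : ∀ {m w} → (w ≢ 0 → m ≡ 1) → m * w ≡ w
      trivial-weight {m} {zero}  _   = *-zeroʳ m
      trivial-weight {m} {suc w} m≡1 = trans (cong (_* suc w) (m≡1 (λ ()))) (+-identityʳ (suc w))

      spread : ∀ x → ∑[ y ∈ ys ] (𝟙 (φ x ≟ᴮ y) * g x) ≡ g x
      spread x = trans (∑∈-*ʳ ys (λ y → 𝟙 (φ x ≟ᴮ y)) (g x)) (trivial-weight (proj₁ ∘ φ-ok x))

      spread′ : ∀ y → ∑[ x ∈ xs ] (𝟙 (ψ y ≟ᴬ x) * h y) ≡ h y
      spread′ y = trans (∑∈-*ʳ xs (λ x → 𝟙 (ψ y ≟ᴬ x)) (h y)) (trivial-weight (proj₁ ∘ ψ-ok y))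

      vanishˡ : ∀ {x y} → φ x ≡ y → ψ y ≢ x → g x ≡ 0
      vanishˡ {x} refl ψφx≢x with g x ≟ 0
      ... | yes gx≡0 = gx≡0
      ... | no  gx≢0 = ⊥-elim (ψφx≢x (proj₁ (proj₂ (φ-ok x gx≢0))))

      vanishʳ : ∀ {x y} → ψ y ≡ x → φ x ≢ y → h y ≡ 0
      vanishʳ {y = y} refl φψy≢y with h y ≟ 0
      ... | yes hy≡0 = hy≡0
      ... | no  hy≢0 = ⊥-elim (φψy≢y (proj₁ (proj₂ (ψ-ok y hy≢0))))

      agree : ∀ {x y} → φ x ≡ y → ψ y ≡ x → g x ≡ h y
      agree {x} {y} φx≡y ψy≡x with g x ≟ 0 | h y ≟ 0
      ... | no  gx≢0 | _        = trans (sym (proj₂ (proj₂ (φ-ok x gx≢0)))) (cong h φx≡y)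
      ... | yes _    | no  hy≢0 = trans (cong g (sym ψy≡x)) (proj₂ (proj₂ (ψ-ok y hy≢0)))
      ... | yes gx≡0 | yes hy≡0 = trans gx≡0 (sym hy≡0)

      linked : ∀ x y → 𝟙 (φ x ≟ᴮ y) * g x ≡ 𝟙 (ψ y ≟ᴬ x) * h y
      linked x y with φ x ≟ᴮ y | ψ y ≟ᴬ x
      ... | yes φx≡y | yes ψy≡x = cong (1 *_) (agree φx≡y ψy≡x)
      ... | yes φx≡y | no  ψy≢x = cong (1 *_) (vanishˡ φx≡y ψy≢x)
      ... | no  φx≢y | yes ψy≡x = cong (1 *_) (sym (vanishʳ ψy≡x φx≢y))
      ... | no  _    | no  _    = refl

multiplicity-cartesianProductWith :
  (_≟ᴬ_ : DecidableEquality A) (_≟ᴮ_ : DecidableEquality B) (_≟ᴰ_ : DecidableEquality D)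
  (h : A → B → D) → (∀ {x x′ y y′} → h x y ≡ h x′ y′ → x ≡ x′ × y ≡ y′) →
  ∀ a b xs ys → multiplicity _≟ᴰ_ (h a b) (cartesianProductWith h xs ys) ≡ multiplicity _≟ᴬ_ a xs * multiplicity _≟ᴮ_ b ys
multiplicity-cartesianProductWith _≟ᴬ_ _≟ᴮ_ _≟ᴰ_ h h-injective a b xs ys = begin
  multiplicity _≟ᴰ_ (h a b) (cartesianProductWith h xs ys)     ≡⟨ ∑∈-cartesianProductWith h xs ys _ ⟩
  ∑[ x ∈ xs ] ∑[ y ∈ ys ] 𝟙 (h a b ≟ᴰ h x y)                    ≡⟨ ∑∈-cong xs (λ x → ∑∈-cong ys (λ y → separate x y)) ⟩
  ∑[ x ∈ xs ] ∑[ y ∈ ys ] (𝟙 (a ≟ᴬ x) * 𝟙 (b ≟ᴮ y))             ≡⟨ ∑∈-cong xs (λ x → ∑∈-*ˡ ys _ (𝟙 (a ≟ᴬ x))) ⟩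
  ∑[ x ∈ xs ] (𝟙 (a ≟ᴬ x) * multiplicity _≟ᴮ_ b ys)            ≡⟨ ∑∈-*ʳ xs _ _ ⟩
  multiplicity _≟ᴬ_ a xs * multiplicity _≟ᴮ_ b ys              ∎
  where
    open ≡-Reasoning
    separate : ∀ x y → 𝟙 (h a b ≟ᴰ h x y) ≡ 𝟙 (a ≟ᴬ x) * 𝟙 (b ≟ᴮ y)
    separate x y = trans (𝟙-cong (h a b ≟ᴰ h x y) ((a ≟ᴬ x) ×-dec (b ≟ᴮ y)) h-injective (λ { (refl , refl) → refl }))
                         (𝟙-× (a ≟ᴬ x) (b ≟ᴮ y))

multiplicity-allFin : ∀ {k} (i : Fin k) → multiplicity Fin._≟_ i (allFin k) ≡ 1
multiplicity-allFin {suc k} i = begin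
  𝟙 (i Fin.≟ zero) + ∑[ j ∈ tabulate suc ] 𝟙 (i Fin.≟ j)
    ≡⟨ cong (λ js → 𝟙 (i Fin.≟ zero) + ∑[ j ∈ js ] 𝟙 (i Fin.≟ j)) (map-tabulate id suc) ⟨
  𝟙 (i Fin.≟ zero) + ∑[ j ∈ map suc (allFin k) ] 𝟙 (i Fin.≟ j)
    ≡⟨ cong (𝟙 (i Fin.≟ zero) +_) (∑∈-map suc (allFin k) _) ⟩
  𝟙 (i Fin.≟ zero) + ∑[ j ∈ allFin k ] 𝟙 (i Fin.≟ suc j)
    ≡⟨ split i ⟩
  1 ∎
  where
    open ≡-Reasoning
    split : ∀ i → 𝟙 (i Fin.≟ zero) + ∑[ j ∈ allFin k ] 𝟙 (i Fin.≟ suc j) ≡ 1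
    split zero    = cong suc (∑∈-const-0 (allFin k))
    split (suc i) = trans (∑∈-cong (allFin k) (λ j → 𝟙-cong (suc i Fin.≟ suc j) (i Fin.≟ j) Fin.suc-injective (cong suc)))
                          (multiplicity-allFin i)

concatMap-map : ∀ (h : A → B → D) xs ys → concatMap (λ x → map (h x) ys) xs ≡ cartesianProductWith h xs ys
concatMap-map h []       ys = refl
concatMap-map h (x ∷ xs) ys = cong (map (h x) ys ++_) (concatMap-map h xs ys)

multiplicity-allVecs : ∀ m k (v : Vec (Fin k) m) → multiplicity (Vec.≡-dec Fin._≟_) v (allVecs m k) ≡ 1
multiplicity-allVecs zero    k []      = refl
multiplicity-allVecs (suc m) k (x ∷ v) = begin
  multiplicity _≟ᵛ_ (x ∷ v) (allVecs (suc m) k)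
    ≡⟨ cong (multiplicity _≟ᵛ_ (x ∷ v)) (concatMap-map _∷_ (allFin k) (allVecs m k)) ⟩
  multiplicity _≟ᵛ_ (x ∷ v) (cartesianProductWith _∷_ (allFin k) (allVecs m k))
    ≡⟨ multiplicity-cartesianProductWith Fin._≟_ _≟ᵛ_ _≟ᵛ_ _∷_ Vec.∷-injective x v (allFin k) (allVecs m k) ⟩
  multiplicity Fin._≟_ x (allFin k) * multiplicity _≟ᵛ_ v (allVecs m k)
    ≡⟨ cong₂ _*_ (multiplicity-allFin x) (multiplicity-allVecs m k v) ⟩
  1 ∎
  where
    open ≡-Reasoning
    _≟ᵛ_ : ∀ {m} → DecidableEquality (Vec (Fin k) m)
    _≟ᵛ_ = Vec.≡-dec Fin._≟_

multiplicity-upTo : ∀ {N i} → i < N → multiplicity _≟_ i (upTo N) ≡ 1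
multiplicity-upTo {N} {i} i<N = begin
  multiplicity _≟_ i (upTo N)  ≡⟨ ∑∈-upTo N _ ⟩
  ∑[ j < N ] 𝟙 (i ≟ j)         ≡⟨ ∑<-single N i<N (λ j _ j≢i → 𝟙-no (i ≟ j) (j≢i ∘ sym)) ⟩
  𝟙 (i ≟ i)                    ≡⟨ 𝟙-yes (i ≟ i) refl ⟩
  1                            ∎
  where open ≡-Reasoning

multiplicity-cartesianProduct :
  (_≟ᴬ_ : DecidableEquality A) (_≟ᴮ_ : DecidableEquality B) → ∀ a b xs ys →
  multiplicity _≟ᴬ_ a xs ≡ 1 → multiplicity _≟ᴮ_ b ys ≡ 1 →
  multiplicity (Product.≡-dec _≟ᴬ_ _≟ᴮ_) (a , b) (cartesianProduct xs ys) ≡ 1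
multiplicity-cartesianProduct _≟ᴬ_ _≟ᴮ_ a b xs ys a-once b-once =
  trans (multiplicity-cartesianProductWith _≟ᴬ_ _≟ᴮ_ (Product.≡-dec _≟ᴬ_ _≟ᴮ_) _,_ Product.,-injective a b xs ys)
        (cong₂ _*_ a-once b-once)

at-lookup : ∀ {k m} (v : Vec (Fin k) m) (i : Fin m) → at v (toℕ i) ≡ toℕ (lookup v i)
at-lookup (x ∷ v) zero    = refl
at-lookup (x ∷ v) (suc i) = at-lookup v i

at-< : ∀ {k m} (v : Vec (Fin k) m) {x} → x < m → at v x < k
at-< (y ∷ v) {zero}  _     = Fin.toℕ<n y
at-< (y ∷ v) {suc x} x<1+m = at-< v (s≤s⁻¹ x<1+m)

at-≥ : ∀ {k m} (v : Vec (Fin k) m) {x} → m ≤ x → at v x ≡ 0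
at-≥ []      _     = refl
at-≥ (y ∷ v) {suc x} 1+m≤x = at-≥ v (s≤s⁻¹ 1+m≤x)

at-injective : ∀ {k m} (v w : Vec (Fin k) m) → (∀ x → x < m → at v x ≡ at w x) → v ≡ w
at-injective []      []      _    = refl
at-injective (y ∷ v) (z ∷ w) v≗w =
  cong₂ _∷_ (Fin.toℕ-injective (v≗w 0 z<s)) (at-injective v w (λ x x<m → v≗w (suc x) (s<s x<m)))

at-tabulate : ∀ {k m} (g : Fin m → Fin k) {x} (x<m : x < m) → at (Vec.tabulate g) x ≡ toℕ (g (fromℕ< x<m))
at-tabulate {m = suc m} g {zero}  _     = refl
at-tabulate {m = suc m} g {suc x} x<1+m = at-tabulate (g ∘ suc) (s≤s⁻¹ x<1+m)

-- Values of F outside [0, m) are reduced mod m; they are never read back.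
fromFunction : (m : ℕ) → (ℕ → ℕ) → Vec (Fin m) m
fromFunction zero    F = []
fromFunction (suc m) F = Vec.tabulate (λ i → F (toℕ i) mod suc m)

at-fromFunction : ∀ m (F : ℕ → ℕ) {x} → x < m → F x < m → at (fromFunction m F) x ≡ F x
at-fromFunction (suc m) F {x} x<m Fx<m = begin
  at (fromFunction (suc m) F) x            ≡⟨ at-tabulate (λ i → F (toℕ i) mod suc m) x<m ⟩
  toℕ (F (toℕ (fromℕ< x<m)) mod suc m)     ≡⟨ Fin.toℕ-fromℕ< _ ⟩
  F (toℕ (fromℕ< x<m)) % suc m             ≡⟨ cong (λ y → F y % suc m) (Fin.toℕ-fromℕ< x<m) ⟩
  F x % suc m                              ≡⟨ m<n⇒m%n≡m Fx<m ⟩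
  F x                                      ∎
  where open ≡-Reasoning

fromFunction-inverse : ∀ m (F : ℕ → ℕ) (v : Vec (Fin m) m) → (∀ x → x < m → F x ≡ at v x) → fromFunction m F ≡ v
fromFunction-inverse m F v F≗v = at-injective (fromFunction m F) v (λ x x<m →
  trans (at-fromFunction m F x<m (subst (_< m) (sym (F≗v x x<m)) (at-< v x<m))) (F≗v x x<m))

record IsMatching (m : ℕ) (f : ℕ → ℕ) : Set where
  field
    <-closed    : ∀ {x} → x < m → f x < m
    involutive  : ∀ {x} → x < m → f (f x) ≡ x
    no-fixpoint : ∀ {x} → x < m → f x ≢ x

open IsMatching

IsMatching-cong : ∀ {m f g} → (∀ x → x < m → f x ≡ g x) → IsMatching m f → IsMatching m g
IsMatching-cong {m} {f} {g} f≗g f-matching = record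
  { <-closed    = λ x<m → subst (_< m) (f≗g _ x<m) (<-closed f-matching x<m)
  ; involutive  = λ {x} x<m →
      trans (sym (f≗g (g x) (gx<m x<m))) (trans (cong f (sym (f≗g x x<m))) (involutive f-matching x<m))
  ; no-fixpoint = λ x<m gx≡x → no-fixpoint f-matching x<m (trans (f≗g _ x<m) gx≡x)
  }
  where
    gx<m : ∀ {x} → x < m → g x < m
    gx<m x<m = subst (_< m) (f≗g _ x<m) (<-closed f-matching x<m)

module _ {m : ℕ} (v : Vec (Fin m) m) where

  private
    Partnered : Fin m → Set
    Partnered i = toℕ (lookup v (lookup v i)) ≡ toℕ i × toℕ (lookup v i) ≢ toℕ i

    partnered? : (i : Fin m) → Dec (Partnered i)
    partnered? i = (toℕ (lookup v (lookup v i)) ≟ toℕ i) ×-dec ¬? (toℕ (lookup v i) ≟ toℕ i)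

    at-at-lookup : ∀ i → at v (at v (toℕ i)) ≡ toℕ (lookup v (lookup v i))
    at-at-lookup i = trans (cong (at v) (at-lookup v i)) (at-lookup v (lookup v i))

  isMatching⇒IsMatching : T (isMatching v) → IsMatching m (at v)
  isMatching⇒IsMatching t = record
    { <-closed    = at-< v
    ; involutive  = λ x<m → subst (λ y → at v (at v y) ≡ y) (Fin.toℕ-fromℕ< x<m)
                              (trans (at-at-lookup _) (proj₁ (partnered (fromℕ< x<m))))
    ; no-fixpoint = λ x<m → subst (λ y → at v y ≢ y) (Fin.toℕ-fromℕ< x<m)
                              (λ e → proj₂ (partnered (fromℕ< x<m)) (trans (sym (at-lookup v _)) e))
    }
    where
      partnered : ∀ i → Partnered i
      partnered i = toWitness (subst T (sym (isYes≗does (partnered? i))) (All.tabulate⁻ (All.all⁺ _ (allFin m) t) i))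

  IsMatching⇒isMatching : IsMatching m (at v) → T (isMatching v)
  IsMatching⇒isMatching v-matching =
    All.all⁻ _ (All.tabulate⁺ (λ i → subst T (isYes≗does (partnered? i)) (fromWitness (partnered i))))
    where
      partnered : ∀ i → Partnered i
      partnered i = trans (sym (at-at-lookup i)) (involutive v-matching (Fin.toℕ<n i))
                  , λ e → no-fixpoint v-matching (Fin.toℕ<n i) (trans (at-lookup v i) e)

∑<-involution : ∀ N {f : ℕ → ℕ} (F : ℕ → ℕ) → (∀ {x} → x < N → f x < N) → (∀ {x} → x < N → f (f x) ≡ x) →
                ∑[ x < N ] F (f x) ≡ ∑< N F
∑<-involution N {f} F f-closed f-involutive = begin
  ∑[ x < N ] F (f x)                    ≡⟨ restrict (F ∘ f) ⟨
  ∑[ x ∈ upTo N ] (𝟙 (x <? N) * F (f x)) ≡⟨ ∑∈-reindex _≟_ _≟_ (upTo N) (upTo N) f f f-ok f-ok′ ⟩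
  ∑[ x ∈ upTo N ] (𝟙 (x <? N) * F x)     ≡⟨ restrict F ⟩
  ∑< N F                                ∎
  where
    open ≡-Reasoning
    -- The factor 𝟙 (x <? N) stands for membership in upTo N, which ∑∈-reindex cannot see.
    restrict : ∀ G → ∑[ x ∈ upTo N ] (𝟙 (x <? N) * G x) ≡ ∑< N G
    restrict G = trans (∑∈-upTo N _) (∑<-cong N (λ x x<N → trans (cong (_* G x) (𝟙-yes (x <? N) x<N)) (+-identityʳ (G x))))

    f-ok : ∀ x → 𝟙 (x <? N) * F (f x) ≢ 0 →
           multiplicity _≟_ (f x) (upTo N) ≡ 1 × f (f x) ≡ x × 𝟙 (f x <? N) * F (f x) ≡ 𝟙 (x <? N) * F (f x)
    f-ok x ne = multiplicity-upTo (f-closed x<N) , f-involutive x<N ,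
                cong (_* F (f x)) (trans (𝟙-yes (f x <? N) (f-closed x<N)) (sym (𝟙-yes (x <? N) x<N)))
      where x<N = 𝟙*≢0⇒ (x <? N) _ ne

    f-ok′ : ∀ y → 𝟙 (y <? N) * F y ≢ 0 →
            multiplicity _≟_ (f y) (upTo N) ≡ 1 × f (f y) ≡ y × 𝟙 (f y <? N) * F (f (f y)) ≡ 𝟙 (y <? N) * F y
    f-ok′ y ne = multiplicity-upTo (f-closed y<N) , f-involutive y<N ,
                 cong₂ _*_ (trans (𝟙-yes (f y <? N) (f-closed y<N)) (sym (𝟙-yes (y <? N) y<N))) (cong F (f-involutive y<N))
      where y<N = 𝟙*≢0⇒ (y <? N) _ ne

-- f exchanges the points with x < f x and those with f x < x, and every point is of exactly one kind.
openers-count : ∀ m {f} → IsMatching (2 * m) f → ∑[ x < 2 * m ] 𝟙 (x <? f x) ≡ m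
openers-count m {f} f-matching = *-cancelˡ-≡ openers m 2 (begin
  2 * openers                                                 ≡⟨ cong (openers +_) (+-identityʳ openers) ⟩
  openers + openers                                           ≡⟨ cong (openers +_) closers≡openers ⟨
  openers + ∑[ x < 2 * m ] 𝟙 (f x <? x)                       ≡⟨ ∑<-+ (2 * m) _ _ ⟨
  ∑[ x < 2 * m ] (𝟙 (x <? f x) + 𝟙 (f x <? x))                ≡⟨ ∑<-cong (2 * m) one-side ⟩
  ∑[ x < 2 * m ] 1                                            ≡⟨ ∑<-const-1 (2 * m) ⟩
  2 * m                                                       ∎)
  where
    open ≡-Reasoning
    openers = ∑[ x < 2 * m ] 𝟙 (x <? f x)

    one-side : ∀ x → x < 2 * m → 𝟙 (x <? f x) + 𝟙 (f x <? x) ≡ 1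
    one-side x x<2m with <-cmp x (f x)
    ... | tri< x<fx _ fx≮x = cong₂ _+_ (𝟙-yes (x <? f x) x<fx) (𝟙-no (f x <? x) fx≮x)
    ... | tri≈ _ x≡fx _    = ⊥-elim (no-fixpoint f-matching x<2m (sym x≡fx))
    ... | tri> x≮fx _ fx<x = cong₂ _+_ (𝟙-no (x <? f x) x≮fx) (𝟙-yes (f x <? x) fx<x)

    closers≡openers : ∑[ x < 2 * m ] 𝟙 (f x <? x) ≡ openers
    closers≡openers = trans
      (∑<-cong (2 * m) (λ x x<2m → 𝟙-cong (f x <? x) (f x <? f (f x))
        (subst (f x <_) (sym (involutive f-matching x<2m))) (subst (f x <_) (involutive f-matching x<2m))))
      (∑<-involution (2 * m) (λ y → 𝟙 (y <? f y)) (<-closed f-matching) (involutive f-matching))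

-- Written exactly like the test in occ21, whose summand is therefore 𝟙 (pattern21? (2 * n) (at v) i j);
-- Occurs below is the same condition with j = f (1 + i) solved for.
Pattern21 : ℕ → (ℕ → ℕ) → ℕ → ℕ → Set
Pattern21 M f i j = i + 2 < j + 1 × j + 2 < M + 1 × f i ≡ j + 1 × f (i + 1) ≡ j

pattern21? : ∀ M f i j → Dec (Pattern21 M f i j)
pattern21? M f i j = (i + 2 <? j + 1) ×-dec (j + 2 <? M + 1) ×-dec (f i ≟ j + 1) ×-dec (f (i + 1) ≟ j)

Occurs : ℕ → (ℕ → ℕ) → ℕ → Set
Occurs M f i = 2 + i ≤ f (1 + i) × 2 + f (1 + i) ≤ M × f i ≡ 1 + f (1 + i)

occurs? : ∀ M f i → Dec (Occurs M f i)
occurs? M f i = (2 + i ≤? f (1 + i)) ×-dec (2 + f (1 + i) ≤? M) ×-dec (f i ≟ 1 + f (1 + i))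

occurrences : ℕ → (ℕ → ℕ) → ℕ
occurrences M f = ∑[ i < M ] 𝟙 (occurs? M f i)

module _ {M : ℕ} {f : ℕ → ℕ} {i : ℕ} where

  private
    <+1⇒≤ : ∀ {a b} → a < b + 1 → a ≤ b
    <+1⇒≤ {a} {b} a<b+1 = s≤s⁻¹ (subst (a <_) (+-comm b 1) a<b+1)

    ≤⇒<+1 : ∀ {a b} → a ≤ b → a < b + 1
    ≤⇒<+1 {a} {b} a≤b = subst (a <_) (+-comm 1 b) (s≤s a≤b)

    i+1≡1+i : i + 1 ≡ 1 + i
    i+1≡1+i = +-comm i 1

  Pattern21⇒Occurs : ∀ {j} → Pattern21 M f i j → Occurs M f i × f (1 + i) ≡ j
  Pattern21⇒Occurs {j} (i+2<j+1 , j+2<M+1 , fi≡j+1 , fi+1≡j) =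
    ( subst₂ _≤_ (+-comm i 2) (sym f1+i≡j) (<+1⇒≤ i+2<j+1)
    , subst (λ y → y ≤ M) (trans (+-comm j 2) (cong (2 +_) (sym f1+i≡j))) (<+1⇒≤ j+2<M+1)
    , trans fi≡j+1 (trans (+-comm j 1) (cong suc (sym f1+i≡j))) )
    , f1+i≡j
    where
      f1+i≡j : f (1 + i) ≡ j
      f1+i≡j = trans (cong f (sym i+1≡1+i)) fi+1≡j

  Occurs⇒Pattern21 : Occurs M f i → Pattern21 M f i (f (1 + i))
  Occurs⇒Pattern21 (2+i≤j , 2+j≤M , fi≡1+j) =
      ≤⇒<+1 (subst (_≤ f (1 + i)) (+-comm 2 i) 2+i≤j)
    , ≤⇒<+1 (subst (_≤ M) (+-comm 2 (f (1 + i))) 2+j≤M)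
    , trans fi≡1+j (+-comm 1 (f (1 + i)))
    , cong f i+1≡1+i

∑<-pattern21 : ∀ M f i → ∑[ j < M ] 𝟙 (pattern21? M f i j) ≡ 𝟙 (occurs? M f i)
∑<-pattern21 M f i with occurs? M f i
... | yes occ = begin
  ∑[ j < M ] 𝟙 (pattern21? M f i j)  ≡⟨ ∑<-single M j<M (λ j _ j≢ → 𝟙-no (pattern21? M f i j) (j≢ ∘ sym ∘ proj₂ ∘ Pattern21⇒Occurs {M} {f})) ⟩
  𝟙 (pattern21? M f i (f (1 + i)))    ≡⟨ 𝟙-yes (pattern21? M f i (f (1 + i))) (Occurs⇒Pattern21 {M} {f} occ) ⟩
  1                                   ≡⟨ 𝟙-yes (occurs? M f i) occ ⟨
  𝟙 (occurs? M f i)                   ∎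
  where
    open ≡-Reasoning
    j<M : f (1 + i) < M
    j<M = ≤-trans (n≤1+n _) (proj₁ (proj₂ occ))
... | no ¬occ = trans (∑<-zero M (λ j _ → 𝟙-no (pattern21? M f i j) (¬occ ∘ proj₁ ∘ Pattern21⇒Occurs {M} {f})))
                      (sym (𝟙-no (occurs? M f i) ¬occ))

occ21≡occurrences : ∀ n v → occ21 n v ≡ occurrences (2 * n) (at v)
occ21≡occurrences n v = trans (∑∈-upTo (2 * n) _)
  (∑<-cong (2 * n) (λ i _ → trans (∑∈-upTo (2 * n) _) (∑<-pattern21 (2 * n) (at v) i)))

Occurs⇒bound : ∀ {M f i} → Occurs M f i → 4 + i ≤ M
Occurs⇒bound (2+i≤j , 2+j≤M , _) = ≤-trans (s≤s (s≤s 2+i≤j)) 2+j≤M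

Occurs-transfer : ∀ {M f g i} → (∀ x → x < M → f x ≡ g x) → Occurs M f i → Occurs M g i
Occurs-transfer {M} {f} {g} {i} f≗g occ@(2+i≤j , 2+j≤M , fi≡1+j) =
  subst (2 + i ≤_) f1+i≡g1+i 2+i≤j ,
  subst (λ j → 2 + j ≤ M) f1+i≡g1+i 2+j≤M ,
  trans (sym (f≗g i (≤-trans (n≤1+n _) 1+i<M))) (trans fi≡1+j (cong suc f1+i≡g1+i))
  where
    1+i<M : 1 + i < M
    1+i<M = ≤-trans (m≤n+m (2 + i) 2) (Occurs⇒bound {f = f} occ)
    f1+i≡g1+i : f (1 + i) ≡ g (1 + i)
    f1+i≡g1+i = f≗g (1 + i) 1+i<M

occurrences-cong : ∀ M {f g} → (∀ x → x < M → f x ≡ g x) → occurrences M f ≡ occurrences M g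
occurrences-cong M {f} {g} f≗g = ∑<-cong M (λ i _ →
  𝟙-cong (occurs? M f i) (occurs? M g i) (Occurs-transfer {f = f} f≗g) (Occurs-transfer {f = g} (λ x x<M → sym (f≗g x x<M))))

-- Old positions x become embed x in a matching on two more points, leaving 1 + p and 1 + q free
-- for the new arc {1 + p , 1 + q}; when p < q, the arc {p , q} becomes {p , 2 + q}.
module Arc (p q : ℕ) where

  embed : ℕ → ℕ
  embed x = punchIn (suc q) (punchIn (suc p) x)

  retract : ℕ → ℕ
  retract y = punchOut (suc p) (punchOut (suc q) y)

  insert : (ℕ → ℕ) → ℕ → ℕ
  insert g y = if does (y ≟ suc p) then suc q else if does (y ≟ suc q) then suc p else embed (g (retract y))

  delete : (ℕ → ℕ) → ℕ → ℕ
  delete f x = retract (f (embed x))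

module NestedArc (p q : ℕ) (p<q : p < q) where

  open Arc p q public

  embed-≤p : ∀ {x} → x ≤ p → embed x ≡ x
  embed-≤p x≤p = trans (cong (punchIn (suc q)) (punchIn-< (s≤s x≤p))) (punchIn-< (s≤s (≤-trans x≤p (<⇒≤ p<q))))

  embed-between : ∀ {x} → p < x → x < q → embed x ≡ suc x
  embed-between p<x x<q = trans (cong (punchIn (suc q)) (punchIn-≥ p<x)) (punchIn-< (s≤s x<q))

  embed-≥q : ∀ {x} → q ≤ x → embed x ≡ 2 + x
  embed-≥q q≤x = trans (cong (punchIn (suc q)) (punchIn-≥ (<-≤-trans p<q q≤x))) (punchIn-≥ (s≤s q≤x))

  retract-embed : ∀ x → retract (embed x) ≡ x
  retract-embed x =
    trans (cong (punchOut (suc p)) (punchOut-punchIn (suc q) (punchIn (suc p) x))) (punchOut-punchIn (suc p) x)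

  embed-injective : ∀ {x y} → embed x ≡ embed y → x ≡ y
  embed-injective {x} {y} e = trans (sym (retract-embed x)) (trans (cong retract e) (retract-embed y))

  embed≢1+q : ∀ x → embed x ≢ suc q
  embed≢1+q x = punchInᵢ≢i (suc q) (punchIn (suc p) x)

  embed≢1+p : ∀ x → embed x ≢ suc p
  embed≢1+p x with x ≤? p
  ... | yes x≤p = λ e → 1+n≰n (subst (_≤ p) (trans (sym (embed-≤p x≤p)) e) x≤p)
  ... | no  x≰p = λ e → 1+n≰n (subst (2 + p ≤_) e 2+p≤embed)
    where
      2+p≤embed : 2 + p ≤ embed x
      2+p≤embed = ≤-trans (s≤s (≰⇒> x≰p)) (≤-trans (≤-reflexive (sym (punchIn-≥ (≰⇒> x≰p)))) (≤-punchIn (suc q) _))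

  embed-retract : ∀ {y} → y ≢ suc p → y ≢ suc q → embed (retract y) ≡ y
  embed-retract {y} y≢1+p y≢1+q = trans (cong (punchIn (suc q)) (punchIn-punchOut skips-1+p)) (punchIn-punchOut y≢1+q)
    where
      skips-1+p : punchOut (suc q) y ≢ suc p
      skips-1+p e = y≢1+p (trans (sym (punchIn-punchOut y≢1+q)) (trans (cong (punchIn (suc q)) e) (punchIn-< (s≤s p<q))))

  embed-≤ : ∀ x → embed x ≤ 2 + x
  embed-≤ x = ≤-trans (punchIn-≤ (suc q) _) (s≤s (punchIn-≤ (suc p) x))

  embed-mono-< : ∀ {x y} → x < y → embed x < embed y
  embed-mono-< x<y = punchIn-mono-< (suc q) (punchIn-mono-< (suc p) x<y)

  embed-mono-≤ : ∀ {x y} → x ≤ y → embed x ≤ embed y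
  embed-mono-≤ x≤y with m≤n⇒m<n∨m≡n x≤y
  ... | inj₁ x<y  = <⇒≤ (embed-mono-< x<y)
  ... | inj₂ refl = ≤-refl

  embed-suc : ∀ {x} → x ≢ p → suc x ≢ q → embed (suc x) ≡ suc (embed x)
  embed-suc {x} x≢p 1+x≢q with <-cmp x p
  ... | tri< x<p _ _ = trans (embed-≤p x<p) (cong suc (sym (embed-≤p (<⇒≤ x<p))))
  ... | tri≈ _ x≡p _ = ⊥-elim (x≢p x≡p)
  ... | tri> _ _ p<x with suc x <? q
  ...   | yes 1+x<q =
    trans (embed-between (m<n⇒m<1+n p<x) 1+x<q) (cong suc (sym (embed-between p<x (<-trans (n<1+n x) 1+x<q))))
  ...   | no  1+x≮q = trans (embed-≥q (≤-trans q≤x (n≤1+n x))) (cong suc (sym (embed-≥q q≤x)))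
    where
      q≤x : q ≤ x
      q≤x = s≤s⁻¹ (≤∧≢⇒< (≮⇒≥ 1+x≮q) (1+x≢q ∘ sym))

  retract-< : ∀ {N y} → q < N → y < 2 + N → y ≢ suc p → y ≢ suc q → retract y < N
  retract-< {N} {y} q<N y<2+N y≢1+p y≢1+q = ≰⇒> λ N≤r → <⇒≱ y<2+N (begin
    2 + N            ≤⟨ s≤s (s≤s N≤r) ⟩
    2 + retract y    ≡⟨ embed-≥q (≤-trans (<⇒≤ q<N) N≤r) ⟨
    embed (retract y) ≡⟨ embed-retract y≢1+p y≢1+q ⟩
    y                ∎)
    where open ≤-Reasoning

  1+q≢1+p : suc q ≢ suc p
  1+q≢1+p e = <-irrefl (sym (suc-injective e)) p<q

  insert-1+p : ∀ g → insert g (suc p) ≡ suc q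
  insert-1+p g = if-yes (suc p ≟ suc p) refl

  insert-1+q : ∀ g → insert g (suc q) ≡ suc p
  insert-1+q g = trans (if-no (suc q ≟ suc p) 1+q≢1+p) (if-yes (suc q ≟ suc q) refl)

  insert-other : ∀ g {y} → y ≢ suc p → y ≢ suc q → insert g y ≡ embed (g (retract y))
  insert-other g {y} y≢1+p y≢1+q = trans (if-no (y ≟ suc p) y≢1+p) (if-no (y ≟ suc q) y≢1+q)

  insert-embed : ∀ g x → insert g (embed x) ≡ embed (g x)
  insert-embed g x = trans (insert-other g (embed≢1+p x) (embed≢1+q x)) (cong (embed ∘ g) (retract-embed x))

  delete-insert : ∀ g x → delete (insert g) x ≡ g x
  delete-insert g x = trans (cong retract (insert-embed g x)) (retract-embed (g x))

  insert-cong : ∀ {N g g′} → q < N → (∀ x → x < N → g x ≡ g′ x) → ∀ y → y < 2 + N → insert g y ≡ insert g′ y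
  insert-cong {N} {g} {g′} q<N g≗g′ y y<2+N with y ≟ suc p | y ≟ suc q
  ... | yes refl   | _          = trans (insert-1+p g) (sym (insert-1+p g′))
  ... | no  _      | yes refl   = trans (insert-1+q g) (sym (insert-1+q g′))
  ... | no  y≢1+p  | no  y≢1+q  = trans (insert-other g y≢1+p y≢1+q)
    (trans (cong embed (g≗g′ _ (retract-< q<N y<2+N y≢1+p y≢1+q))) (sym (insert-other g′ y≢1+p y≢1+q)))

module Insertion {N : ℕ} {g : ℕ → ℕ} (g-matching : IsMatching N g)
                 {p q : ℕ} (p<N : p < N) (gp≡q : g p ≡ q) (p<q : p < q) where

  open NestedArc p q p<q public

  q<N : q < N
  q<N = subst (_< N) gp≡q (<-closed g-matching p<N)

  gq≡p : g q ≡ p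
  gq≡p = trans (cong g (sym gp≡q)) (involutive g-matching p<N)

  q≢p : q ≢ p
  q≢p q≡p = <-irrefl (sym q≡p) p<q

  v : ℕ → ℕ
  v = insert g

  insert-IsMatching : IsMatching (2 + N) v
  insert-IsMatching = record
    { <-closed    = λ y< → proj₁ (partner y<)
    ; involutive  = λ y< → proj₁ (proj₂ (partner y<))
    ; no-fixpoint = λ y< → proj₂ (proj₂ (partner y<))
    }
    where
      partner : ∀ {y} → y < 2 + N → v y < 2 + N × v (v y) ≡ y × v y ≢ y
      partner {y} y<2+N with y ≟ suc p | y ≟ suc q
      ... | yes refl | _ =
        subst (_< 2 + N) (sym (insert-1+p g)) (s≤s (m<n⇒m<1+n q<N)) ,
        trans (cong v (insert-1+p g)) (insert-1+q g) ,
        λ e → q≢p (suc-injective (trans (sym (insert-1+p g)) e))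
      ... | no _ | yes refl =
        subst (_< 2 + N) (sym (insert-1+q g)) (s≤s (m<n⇒m<1+n p<N)) ,
        trans (cong v (insert-1+q g)) (insert-1+p g) ,
        λ e → q≢p (sym (suc-injective (trans (sym (insert-1+q g)) e)))
      ... | no y≢1+p | no y≢1+q =
        subst (_< 2 + N) (sym vy≡) (≤-<-trans (embed-≤ (g x)) (s≤s (s≤s (<-closed g-matching x<N)))) ,
        trans (cong v vy≡) (trans (insert-embed g (g x)) (trans (cong embed (involutive g-matching x<N)) embed-x≡y)) ,
        λ e → no-fixpoint g-matching x<N (embed-injective (trans (sym vy≡) (trans e (sym embed-x≡y))))
        where
          x = retract y
          x<N = retract-< q<N y<2+N y≢1+p y≢1+q
          embed-x≡y = embed-retract y≢1+p y≢1+q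
          vy≡ : v y ≡ embed (g x)
          vy≡ = insert-other g y≢1+p y≢1+q

  vp≡2+q : v p ≡ 2 + q
  vp≡2+q = trans (cong v (sym (embed-≤p ≤-refl))) (trans (insert-embed g p) (trans (cong embed gp≡q) (embed-≥q ≤-refl)))

  Occurs-insert-p : Occurs (2 + N) v p
  Occurs-insert-p =
    subst (2 + p ≤_) (sym (insert-1+p g)) (s≤s p<q) ,
    subst (λ j → 2 + j ≤ 2 + N) (sym (insert-1+p g)) (s≤s (s≤s q<N)) ,
    trans vp≡2+q (cong suc (sym (insert-1+p g)))

  ¬Occurs-insert-1+q : ¬ Occurs (2 + N) v (suc q)
  ¬Occurs-insert-1+q (3+q≤j , _ , v1+q≡1+j) = <⇒≱ p<q (≤-trans (m≤n+m q 3) (subst (3 + q ≤_) j≡p 3+q≤j))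
    where
      j≡p : v (2 + q) ≡ p
      j≡p = sym (suc-injective (trans (sym (insert-1+q g)) v1+q≡1+j))

  embed≤N⇒2+≤N : ∀ {b} → embed b ≤ N → 2 + b ≤ N
  embed≤N⇒2+≤N {b} embed-b≤N with b <? q
  ... | yes b<q = ≤-trans (s≤s b<q) q<N
  ... | no  b≮q = ≤-trans (≤-reflexive (sym (embed-≥q (≮⇒≥ b≮q)))) embed-b≤N

  insert-2+p : suc p < q → v (2 + p) ≡ embed (g (suc p))
  insert-2+p 1+p<q = trans (cong v (sym (embed-between ≤-refl 1+p<q))) (insert-embed g (suc p))

  Occurs-insert-1+p⇒ : Occurs (2 + N) v (suc p) → Occurs N g p
  Occurs-insert-1+p⇒ (3+p≤j , _ , v1+p≡1+j) with suc p ≟ q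
  ... | yes 1+p≡q = ⊥-elim (1+n≰n (≤-trans (n≤1+n _) (subst (3 + p ≤_) v2+p≡1+p 3+p≤j)))
    where
      v2+p≡1+p : v (2 + p) ≡ suc p
      v2+p≡1+p = trans (cong (v ∘ suc) 1+p≡q) (insert-1+q g)
  ... | no  1+p≢q = 2+p≤b , subst (_≤ N) (cong suc q≡1+b) q<N , trans gp≡q q≡1+b
    where
      b = g (suc p)
      v2+p≡eb : v (2 + p) ≡ embed b
      v2+p≡eb = insert-2+p (≤∧≢⇒< p<q 1+p≢q)
      q≡eb : q ≡ embed b
      q≡eb = suc-injective (trans (sym (insert-1+p g)) (trans v1+p≡1+j (cong suc v2+p≡eb)))
      q≡1+b : q ≡ suc b
      q≡1+b with b ≤? p | q ≤? b
      ... | yes b≤p | _       = ⊥-elim (<⇒≱ p<q (subst (_≤ p) (sym (trans q≡eb (embed-≤p b≤p))) b≤p))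
      ... | no  _   | yes q≤b = ⊥-elim (1+n≰n (≤-trans (n≤1+n (suc b)) (subst (_≤ b) (trans q≡eb (embed-≥q q≤b)) q≤b)))
      ... | no  b≰p | no  q≰b = trans q≡eb (embed-between (≰⇒> b≰p) (≰⇒> q≰b))
      2+p≤b : 2 + p ≤ b
      2+p≤b = s≤s⁻¹ (subst (3 + p ≤_) (trans v2+p≡eb (trans (sym q≡eb) q≡1+b)) 3+p≤j)

  Occurs-insert-1+p⇐ : Occurs N g p → Occurs (2 + N) v (suc p)
  Occurs-insert-1+p⇐ (2+p≤b , 2+b≤N , gp≡1+b) =
    subst (3 + p ≤_) (sym v2+p≡1+b) (s≤s 2+p≤b) ,
    subst (λ j → 2 + j ≤ 2 + N) (sym v2+p≡1+b) (s≤s (s≤s (subst (_≤ N) q≡1+b (<⇒≤ q<N)))) ,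
    trans (insert-1+p g) (cong suc (trans q≡1+b (sym v2+p≡1+b)))
    where
      b = g (suc p)
      q≡1+b : q ≡ suc b
      q≡1+b = trans (sym gp≡q) gp≡1+b
      v2+p≡1+b : v (2 + p) ≡ suc b
      v2+p≡1+b = trans (insert-2+p (subst (suc p <_) (sym q≡1+b) (m≤n⇒m≤1+n 2+p≤b)))
                       (embed-between (≤-trans (n≤1+n _) 2+p≤b) (subst (b <_) (sym q≡1+b) ≤-refl))

  insert-suc-embed : ∀ {x} → x ≢ p → suc x ≢ q → v (suc (embed x)) ≡ embed (g (suc x))
  insert-suc-embed {x} x≢p 1+x≢q = trans (cong v (sym (embed-suc x≢p 1+x≢q))) (insert-embed g (suc x))

  Occurs-insert-embed⇒ : ∀ {x} → x ≢ p → Occurs (2 + N) v (embed x) → Occurs N g x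
  Occurs-insert-embed⇒ {x} x≢p (2+ex≤j , 2+j≤2+N , vex≡1+j) = 2+x≤b , embed≤N⇒2+≤N (s≤s⁻¹ (s≤s⁻¹ 2+eb≤2+N)) , c≡1+b
    where
      b = g (suc x)
      c = g x
      1+x≢q : suc x ≢ q
      1+x≢q 1+x≡q = <⇒≱ p<q (≤-trans (n≤1+n q) (s≤s⁻¹ (subst₂ (λ e j → 2 + e ≤ j) ex≡q v1+q≡1+p 2+ex≤j)))
        where
          p<x = ≤∧≢⇒< (s≤s⁻¹ (subst (p <_) (sym 1+x≡q) p<q)) (x≢p ∘ sym)
          ex≡q = trans (embed-between p<x (subst (x <_) 1+x≡q ≤-refl)) 1+x≡q
          v1+q≡1+p = trans (cong (v ∘ suc) ex≡q) (insert-1+q g)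
      2+ex≤eb : 2 + embed x ≤ embed b
      2+ex≤eb = subst (2 + embed x ≤_) (insert-suc-embed x≢p 1+x≢q) 2+ex≤j
      2+eb≤2+N : 2 + embed b ≤ 2 + N
      2+eb≤2+N = subst (λ j → 2 + j ≤ 2 + N) (insert-suc-embed x≢p 1+x≢q) 2+j≤2+N
      ec≡1+eb : embed c ≡ suc (embed b)
      ec≡1+eb = trans (sym (insert-embed g x)) (trans vex≡1+j (cong suc (insert-suc-embed x≢p 1+x≢q)))
      c≡1+b : c ≡ suc b
      c≡1+b with b ≟ p | suc b ≟ q
      ... | yes b≡p | _         = ⊥-elim (embed≢1+p c (trans ec≡1+eb (cong suc (trans (cong embed b≡p) (embed-≤p ≤-refl)))))
      ... | no  b≢p | yes 1+b≡q = ⊥-elim (embed≢1+q c (trans ec≡1+eb (cong suc (trans (embed-between p<b b<q) 1+b≡q))))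
        where
          b<q = subst (b <_) 1+b≡q ≤-refl
          p<b = ≤∧≢⇒< (s≤s⁻¹ (subst (p <_) (sym 1+b≡q) p<q)) (b≢p ∘ sym)
      ... | no  b≢p | no  1+b≢q = embed-injective (trans ec≡1+eb (sym (embed-suc b≢p 1+b≢q)))
      2+x≤b : 2 + x ≤ b
      2+x≤b = ≰⇒> λ b≤1+x → <⇒≱ 2+ex≤eb (subst (embed b ≤_) (embed-suc x≢p 1+x≢q) (embed-mono-≤ b≤1+x))

  Occurs-insert-embed⇐ : ∀ {x} → x < N → x ≢ p → Occurs N g x → Occurs (2 + N) v (embed x)
  Occurs-insert-embed⇐ {x} x<N x≢p occ@(2+x≤b , 2+b≤N , c≡1+b) =
    subst (2 + embed x ≤_) (sym (insert-suc-embed x≢p 1+x≢q)) 2+ex≤eb ,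
    subst (λ j → 2 + j ≤ 2 + N) (sym (insert-suc-embed x≢p 1+x≢q)) (s≤s (s≤s (≤-trans (embed-≤ b) 2+b≤N))) ,
    trans (insert-embed g x)
          (trans (cong embed c≡1+b) (trans (embed-suc b≢p 1+b≢q) (cong suc (sym (insert-suc-embed x≢p 1+x≢q)))))
    where
      b = g (suc x)
      1+x≢q : suc x ≢ q
      1+x≢q 1+x≡q = 1+n≰n (≤-trans (n≤1+n (suc x)) (≤-trans 2+x≤p p≤x))
        where
          p≤x = s≤s⁻¹ (subst (p <_) (sym 1+x≡q) p<q)
          2+x≤p = subst (2 + x ≤_) (trans (cong g 1+x≡q) gq≡p) 2+x≤b
      1+x<N : suc x < N
      1+x<N = ≤-trans (m≤n+m (2 + x) 2) (Occurs⇒bound {f = g} occ)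
      b≢p : b ≢ p
      b≢p b≡p = 1+x≢q (trans (sym (involutive g-matching 1+x<N)) (trans (cong g b≡p) gp≡q))
      1+b≢q : suc b ≢ q
      1+b≢q 1+b≡q = x≢p (trans (sym (involutive g-matching x<N)) (trans (cong g (trans c≡1+b 1+b≡q)) gq≡p))
      2+ex≤eb : 2 + embed x ≤ embed b
      2+ex≤eb = ≤-trans (subst (λ e → suc e ≤ embed (2 + x)) (embed-suc x≢p 1+x≢q) (embed-mono-< (n<1+n (suc x))))
                        (embed-mono-≤ 2+x≤b)

  occurrences-insert : occurrences (2 + N) v ≡ suc (occurrences N g)
  occurrences-insert = begin
    occurrences (2 + N) v
      ≡⟨ ∑<-punchIn (suc N) (O v) (s≤s (<⇒≤ q<N)) ⟩
    ∑[ y < suc N ] O v (punchIn (suc q) y) + O v (suc q)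
      ≡⟨ cong₂ _+_ (∑<-punchIn N _ p<N) (𝟙-no (occurs? (2 + N) v (suc q)) ¬Occurs-insert-1+q) ⟩
    ∑[ x < N ] O v (embed x) + O v (punchIn (suc q) (suc p)) + 0
      ≡⟨ +-identityʳ _ ⟩
    ∑[ x < N ] O v (embed x) + O v (punchIn (suc q) (suc p))
      ≡⟨ cong (λ y → ∑[ x < N ] O v (embed x) + O v y) (punchIn-< (s≤s p<q)) ⟩
    ∑[ x < N ] O v (embed x) + O v (suc p)
      ≡⟨ cong (∑[ x < N ] O v (embed x) +_) (O-cong Occurs-insert-1+p⇒ Occurs-insert-1+p⇐) ⟩
    ∑[ x < N ] O v (embed x) + O′ g p
      ≡⟨ ∑<-exchange N p<N (λ x x<N x≢p → O-cong (Occurs-insert-embed⇒ x≢p) (Occurs-insert-embed⇐ x<N x≢p)) ⟩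
    occurrences N g + O v (embed p)
      ≡⟨ cong (λ y → occurrences N g + O v y) (embed-≤p ≤-refl) ⟩
    occurrences N g + O v p
      ≡⟨ cong (occurrences N g +_) (𝟙-yes (occurs? (2 + N) v p) Occurs-insert-p) ⟩
    occurrences N g + 1
      ≡⟨ +-comm (occurrences N g) 1 ⟩
    suc (occurrences N g) ∎
    where
      open ≡-Reasoning
      O : (ℕ → ℕ) → ℕ → ℕ
      O f y = 𝟙 (occurs? (2 + N) f y)
      O′ : (ℕ → ℕ) → ℕ → ℕ
      O′ f x = 𝟙 (occurs? N f x)
      O-cong : ∀ {y x} → (Occurs (2 + N) v y → Occurs N g x) → (Occurs N g x → Occurs (2 + N) v y) → O v y ≡ O′ g x
      O-cong {y} {x} = 𝟙-cong (occurs? (2 + N) v y) (occurs? N g x)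

module Deletion {N : ℕ} {f : ℕ → ℕ} (f-matching : IsMatching (2 + N) f)
                {p : ℕ} (occ : Occurs (2 + N) f p) where

  q : ℕ
  q = pred (f (suc p))

  f1+p≡1+q : f (suc p) ≡ suc q
  f1+p≡1+q with f (suc p) | proj₁ occ
  ... | suc _ | _ = refl

  p<q : p < q
  p<q = s≤s⁻¹ (subst (2 + p ≤_) f1+p≡1+q (proj₁ occ))

  q<N : q < N
  q<N = s≤s⁻¹ (s≤s⁻¹ (subst (λ j → 2 + j ≤ 2 + N) f1+p≡1+q (proj₁ (proj₂ occ))))

  p<N : p < N
  p<N = <-trans p<q q<N

  open NestedArc p q p<q public

  w : ℕ → ℕ
  w = delete f

  fp≡2+q : f p ≡ 2 + q
  fp≡2+q = trans (proj₂ (proj₂ occ)) (cong suc f1+p≡1+q)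

  f1+q≡1+p : f (suc q) ≡ suc p
  f1+q≡1+p = trans (cong f (sym f1+p≡1+q)) (involutive f-matching (s≤s (m<n⇒m<1+n p<N)))

  avoids : ∀ {y} → y < 2 + N → y ≢ suc p → y ≢ suc q → f y ≢ suc p × f y ≢ suc q
  avoids y<2+N y≢1+p y≢1+q =
    (λ fy≡1+p → y≢1+q (trans (sym (involutive f-matching y<2+N)) (trans (cong f fy≡1+p) f1+p≡1+q))) ,
    (λ fy≡1+q → y≢1+p (trans (sym (involutive f-matching y<2+N)) (trans (cong f fy≡1+q) f1+q≡1+p)))

  delete-IsMatching : IsMatching N w
  delete-IsMatching = record
    { <-closed    = λ x<N → retract-< q<N (fy<2+N x<N) (proj₁ (avoids′ x<N)) (proj₂ (avoids′ x<N))
    ; involutive  = λ {x} x<N → trans (cong (retract ∘ f) (embed-retract (proj₁ (avoids′ x<N)) (proj₂ (avoids′ x<N))))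
                                       (trans (cong retract (involutive f-matching (embed<2+N x<N))) (retract-embed x))
    ; no-fixpoint = λ {x} x<N wx≡x → no-fixpoint f-matching (embed<2+N x<N)
                        (trans (sym (embed-retract (proj₁ (avoids′ x<N)) (proj₂ (avoids′ x<N)))) (cong embed wx≡x))
    }
    where
      embed<2+N : ∀ {x} → x < N → embed x < 2 + N
      embed<2+N {x} x<N = ≤-<-trans (embed-≤ x) (s≤s (s≤s x<N))
      fy<2+N : ∀ {x} → x < N → f (embed x) < 2 + N
      fy<2+N x<N = <-closed f-matching (embed<2+N x<N)
      avoids′ : ∀ {x} → x < N → f (embed x) ≢ suc p × f (embed x) ≢ suc q
      avoids′ {x} x<N = avoids (embed<2+N x<N) (embed≢1+p x) (embed≢1+q x)

  delete-p : w p ≡ q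
  delete-p = begin
    retract (f (embed p))  ≡⟨ cong (retract ∘ f) (embed-≤p ≤-refl) ⟩
    retract (f p)          ≡⟨ cong retract (trans fp≡2+q (sym (embed-≥q ≤-refl))) ⟩
    retract (embed q)      ≡⟨ retract-embed q ⟩
    q                      ∎
    where open ≡-Reasoning

  insert-delete : ∀ y → y < 2 + N → insert w y ≡ f y
  insert-delete y y<2+N with y ≟ suc p | y ≟ suc q
  ... | yes refl  | _         = trans (insert-1+p w) (sym f1+p≡1+q)
  ... | no  _     | yes refl  = trans (insert-1+q w) (sym f1+q≡1+p)
  ... | no  y≢1+p | no  y≢1+q = begin
    insert w y
      ≡⟨ insert-other w y≢1+p y≢1+q ⟩
    embed (retract (f (embed (retract y))))
      ≡⟨ cong (embed ∘ retract ∘ f) (embed-retract y≢1+p y≢1+q) ⟩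
    embed (retract (f y))
      ≡⟨ embed-retract (proj₁ (avoids y<2+N y≢1+p y≢1+q)) (proj₂ (avoids y<2+N y≢1+p y≢1+q)) ⟩
    f y ∎
    where open ≡-Reasoning

  occurrences-delete : occurrences (2 + N) f ≡ suc (occurrences N w)
  occurrences-delete = begin
    occurrences (2 + N) f                ≡⟨ occurrences-cong (2 + N) (λ y y< → sym (insert-delete y y<)) ⟩
    occurrences (2 + N) (insert w)       ≡⟨ Insertion.occurrences-insert delete-IsMatching p<N delete-p p<q ⟩
    suc (occurrences N w)                ∎
    where open ≡-Reasoning

MatchingWith : ∀ {N} → ℕ → Vec (Fin N) N → Set
MatchingWith {N} k v = T (isMatching v) × occurrences N (at v) ≡ k

-- 𝟙 (matchingWith? k v) unfolds to the filter test in a, with occurrences in place of occ21.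
matchingWith? : ∀ {N} k (v : Vec (Fin N) N) → Dec (MatchingWith k v)
matchingWith? {N} k v = T? (isMatching v) ×-dec (occurrences N (at v) ≟ k)

matchings : ℕ → ℕ → ℕ
matchings N k = ∑[ v ∈ allVecs N N ] 𝟙 (matchingWith? k v)

a≡matchings : ∀ n k → a n k ≡ matchings (2 * n) k
a≡matchings n k = trans (length-filter-T? _ (allVecs (2 * n) (2 * n)))
  (∑∈-cong (allVecs (2 * n) (2 * n)) (λ v → cong (λ o → χ (isMatching v ∧ (o ≡ᵇ k))) (occ21≡occurrences n v)))

MarkedOccurrence : ∀ {M} → ℕ → Vec (Fin M) M × ℕ → Set
MarkedOccurrence {M} k (v , i) = MatchingWith (suc k) v × Occurs M (at v) i

markedOccurrence? : ∀ {M} k (x : Vec (Fin M) M × ℕ) → Dec (MarkedOccurrence k x)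
markedOccurrence? {M} k (v , i) = matchingWith? (suc k) v ×-dec occurs? M (at v) i

MarkedArc : ∀ {N} → ℕ → Vec (Fin N) N × ℕ → Set
MarkedArc k (w , p) = MatchingWith k w × p < at w p

markedArc? : ∀ {N} k (y : Vec (Fin N) N × ℕ) → Dec (MarkedArc k y)
markedArc? k (w , p) = matchingWith? k w ×-dec (p <? at w p)

allPointed : ∀ N → List (Vec (Fin N) N × ℕ)
allPointed N = cartesianProduct (allVecs N N) (upTo N)

_≟ᵖ_ : ∀ {N} → DecidableEquality (Vec (Fin N) N × ℕ)
_≟ᵖ_ = Product.≡-dec (Vec.≡-dec Fin._≟_) _≟_

multiplicity-allPointed : ∀ {N} (v : Vec (Fin N) N) {i} → i < N → multiplicity _≟ᵖ_ (v , i) (allPointed N) ≡ 1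
multiplicity-allPointed {N} v i<N = multiplicity-cartesianProduct (Vec.≡-dec Fin._≟_) _≟_ v _ (allVecs N N) (upTo N)
                                      (multiplicity-allVecs N N v) (multiplicity-upTo i<N)

∑-markedOccurrences : ∀ M k → ∑[ x ∈ allPointed M ] 𝟙 (markedOccurrence? k x) ≡ matchings M (suc k) * suc k
∑-markedOccurrences M k = begin
  ∑[ x ∈ allPointed M ] 𝟙 (markedOccurrence? k x)
    ≡⟨ ∑∈-cartesianProductWith _,_ (allVecs M M) (upTo M) _ ⟩
  ∑[ v ∈ allVecs M M ] ∑[ i ∈ upTo M ] 𝟙 (markedOccurrence? k (v , i))
    ≡⟨ ∑∈-cong (allVecs M M) per-vector ⟩
  ∑[ v ∈ allVecs M M ] (𝟙 (matchingWith? (suc k) v) * suc k)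
    ≡⟨ ∑∈-*ʳ (allVecs M M) (λ v → 𝟙 (matchingWith? (suc k) v)) (suc k) ⟩
  matchings M (suc k) * suc k ∎
  where
    open ≡-Reasoning
    per-vector : ∀ v → ∑[ i ∈ upTo M ] 𝟙 (markedOccurrence? k (v , i)) ≡ 𝟙 (matchingWith? (suc k) v) * suc k
    per-vector v = begin
      ∑[ i ∈ upTo M ] 𝟙 (markedOccurrence? k (v , i))
        ≡⟨ ∑∈-cong (upTo M) (λ i → 𝟙-× (matchingWith? (suc k) v) (occurs? M (at v) i)) ⟩
      ∑[ i ∈ upTo M ] (𝟙 (matchingWith? (suc k) v) * 𝟙 (occurs? M (at v) i))
        ≡⟨ ∑∈-*ˡ (upTo M) (λ i → 𝟙 (occurs? M (at v) i)) (𝟙 (matchingWith? (suc k) v)) ⟩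
      𝟙 (matchingWith? (suc k) v) * ∑[ i ∈ upTo M ] 𝟙 (occurs? M (at v) i)
        ≡⟨ cong (𝟙 (matchingWith? (suc k) v) *_) (∑∈-upTo M _) ⟩
      𝟙 (matchingWith? (suc k) v) * occurrences M (at v)
        ≡⟨ 𝟙-*-cong (matchingWith? (suc k) v) proj₂ ⟩
      𝟙 (matchingWith? (suc k) v) * suc k ∎

∑-markedArcs : ∀ n k → ∑[ y ∈ allPointed (2 * n) ] 𝟙 (markedArc? k y) ≡ matchings (2 * n) k * n
∑-markedArcs n k = begin
  ∑[ y ∈ allPointed N ] 𝟙 (markedArc? k y)
    ≡⟨ ∑∈-cartesianProductWith _,_ (allVecs N N) (upTo N) _ ⟩
  ∑[ w ∈ allVecs N N ] ∑[ p ∈ upTo N ] 𝟙 (markedArc? k (w , p))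
    ≡⟨ ∑∈-cong (allVecs N N) per-vector ⟩
  ∑[ w ∈ allVecs N N ] (𝟙 (matchingWith? k w) * n)
    ≡⟨ ∑∈-*ʳ (allVecs N N) (λ w → 𝟙 (matchingWith? k w)) n ⟩
  matchings N k * n ∎
  where
    open ≡-Reasoning
    N = 2 * n
    per-vector : ∀ w → ∑[ p ∈ upTo N ] 𝟙 (markedArc? k (w , p)) ≡ 𝟙 (matchingWith? k w) * n
    per-vector w = begin
      ∑[ p ∈ upTo N ] 𝟙 (markedArc? k (w , p))
        ≡⟨ ∑∈-cong (upTo N) (λ p → 𝟙-× (matchingWith? k w) (p <? at w p)) ⟩
      ∑[ p ∈ upTo N ] (𝟙 (matchingWith? k w) * 𝟙 (p <? at w p))
        ≡⟨ ∑∈-*ˡ (upTo N) (λ p → 𝟙 (p <? at w p)) (𝟙 (matchingWith? k w)) ⟩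
      𝟙 (matchingWith? k w) * ∑[ p ∈ upTo N ] 𝟙 (p <? at w p)
        ≡⟨ cong (𝟙 (matchingWith? k w) *_) (∑∈-upTo N _) ⟩
      𝟙 (matchingWith? k w) * ∑[ p < N ] 𝟙 (p <? at w p)
        ≡⟨ 𝟙-*-cong (matchingWith? k w) (openers-count n ∘ isMatching⇒IsMatching w ∘ proj₁) ⟩
      𝟙 (matchingWith? k w) * n ∎

MarkedArc⇒< : ∀ {N k} (y : Vec (Fin N) N × ℕ) → MarkedArc k y → proj₂ y < N
MarkedArc⇒< (w , p) (_ , p<wp) = ≰⇒> λ N≤p → n≮0 (subst (p <_) (at-≥ w N≤p) p<wp)

MarkedOccurrence⇒< : ∀ {M k} (x : Vec (Fin M) M × ℕ) → MarkedOccurrence k x → proj₂ x < M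
MarkedOccurrence⇒< {M} (v , i) (_ , occ) = ≤-trans (m≤n+m (suc i) 3) (Occurs⇒bound {f = at v} occ)

module _ {N : ℕ} (k : ℕ) where

  deleteMarked : Vec (Fin (2 + N)) (2 + N) × ℕ → Vec (Fin N) N × ℕ
  deleteMarked (v , i) = fromFunction N (Arc.delete i (pred (at v (suc i))) (at v)) , i

  insertMarked : Vec (Fin N) N × ℕ → Vec (Fin (2 + N)) (2 + N) × ℕ
  insertMarked (w , p) = fromFunction (2 + N) (Arc.insert p (at w p) (at w)) , p

  deleteMarked-sound : ∀ x → MarkedOccurrence k x → MarkedArc k (deleteMarked x) × insertMarked (deleteMarked x) ≡ x
  deleteMarked-sound (v , i) ((v-matching , occurrences≡1+k) , occ) =
    ((IsMatching⇒isMatching W W-matching , occurrences-W) , subst (i <_) (sym at-W-i) p<q) ,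
    cong (_, i) (fromFunction-inverse (2 + N) (Arc.insert i (at W i) (at W)) v insert-W)
    where
      open Deletion (isMatching⇒IsMatching v v-matching) occ
      W = fromFunction N w
      at-W : ∀ x → x < N → at W x ≡ w x
      at-W x x<N = at-fromFunction N w x<N (<-closed delete-IsMatching x<N)
      W-matching : IsMatching N (at W)
      W-matching = IsMatching-cong (λ x x<N → sym (at-W x x<N)) delete-IsMatching
      at-W-i : at W i ≡ q
      at-W-i = trans (at-W i p<N) delete-p
      occurrences-W : occurrences N (at W) ≡ k
      occurrences-W = suc-injective (begin
        suc (occurrences N (at W))  ≡⟨ cong suc (occurrences-cong N at-W) ⟩
        suc (occurrences N w)       ≡⟨ occurrences-delete ⟨
        occurrences (2 + N) (at v)  ≡⟨ occurrences≡1+k ⟩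
        suc k                       ∎)
        where open ≡-Reasoning
      insert-W : ∀ y → y < 2 + N → Arc.insert i (at W i) (at W) y ≡ at v y
      insert-W y y<2+N = begin
        Arc.insert i (at W i) (at W) y  ≡⟨ cong (λ j → Arc.insert i j (at W) y) at-W-i ⟩
        insert (at W) y                 ≡⟨ insert-cong q<N at-W y y<2+N ⟩
        insert w y                      ≡⟨ insert-delete y y<2+N ⟩
        at v y                          ∎
        where open ≡-Reasoning

  insertMarked-sound : ∀ y → MarkedArc k y → MarkedOccurrence k (insertMarked y) × deleteMarked (insertMarked y) ≡ y
  insertMarked-sound (w , p) ((w-matching , occurrences≡k) , p<q) =
    ((IsMatching⇒isMatching V V-matching , occurrences-V) , Occurs-transfer (λ y y<2+N → sym (at-V y y<2+N)) Occurs-insert-p) ,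
    cong (_, p) (fromFunction-inverse N (Arc.delete p (pred (at V (suc p))) (at V)) w delete-V)
    where
      p<N : p < N
      p<N = MarkedArc⇒< (w , p) ((w-matching , occurrences≡k) , p<q)
      open Insertion (isMatching⇒IsMatching w w-matching) p<N refl p<q
      V = fromFunction (2 + N) v
      at-V : ∀ y → y < 2 + N → at V y ≡ v y
      at-V y y<2+N = at-fromFunction (2 + N) v y<2+N (<-closed insert-IsMatching y<2+N)
      V-matching : IsMatching (2 + N) (at V)
      V-matching = IsMatching-cong (λ y y<2+N → sym (at-V y y<2+N)) insert-IsMatching
      occurrences-V : occurrences (2 + N) (at V) ≡ suc k
      occurrences-V = trans (occurrences-cong (2 + N) at-V) (trans occurrences-insert (cong suc occurrences≡k))
      delete-V : ∀ x → x < N → Arc.delete p (pred (at V (suc p))) (at V) x ≡ at w x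
      delete-V x x<N = begin
        Arc.delete p (pred (at V (suc p))) (at V) x
          ≡⟨ cong (λ j → Arc.delete p (pred j) (at V) x) (trans (at-V (suc p) (s≤s (m<n⇒m<1+n p<N))) (insert-1+p (at w))) ⟩
        retract (at V (embed x))
          ≡⟨ cong retract (at-V (embed x) (≤-<-trans (embed-≤ x) (s≤s (s≤s x<N)))) ⟩
        delete v x
          ≡⟨ delete-insert (at w) x ⟩
        at w x ∎
        where open ≡-Reasoning

  markedOccurrences≡markedArcs :
    ∑[ x ∈ allPointed (2 + N) ] 𝟙 (markedOccurrence? k x) ≡ ∑[ y ∈ allPointed N ] 𝟙 (markedArc? k y)
  markedOccurrences≡markedArcs =
    ∑∈-reindex _≟ᵖ_ _≟ᵖ_ (allPointed (2 + N)) (allPointed N) deleteMarked insertMarked delete-ok insert-ok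
    where
      delete-ok : ∀ x → 𝟙 (markedOccurrence? k x) ≢ 0 →
                  multiplicity _≟ᵖ_ (deleteMarked x) (allPointed N) ≡ 1 × insertMarked (deleteMarked x) ≡ x ×
                  𝟙 (markedArc? k (deleteMarked x)) ≡ 𝟙 (markedOccurrence? k x)
      delete-ok x ne = multiplicity-allPointed (proj₁ (deleteMarked x)) (MarkedArc⇒< (deleteMarked x) arc) , round-trip ,
                       trans (𝟙-yes (markedArc? k (deleteMarked x)) arc) (sym (𝟙-yes (markedOccurrence? k x) marked))
        where
          marked = 𝟙≢0⇒ (markedOccurrence? k x) ne
          arc = proj₁ (deleteMarked-sound x marked)
          round-trip = proj₂ (deleteMarked-sound x marked)

      insert-ok : ∀ y → 𝟙 (markedArc? k y) ≢ 0 →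
                  multiplicity _≟ᵖ_ (insertMarked y) (allPointed (2 + N)) ≡ 1 × deleteMarked (insertMarked y) ≡ y ×
                  𝟙 (markedOccurrence? k (insertMarked y)) ≡ 𝟙 (markedArc? k y)
      insert-ok y ne = multiplicity-allPointed (proj₁ (insertMarked y)) (MarkedOccurrence⇒< (insertMarked y) occ) ,
                       round-trip ,
                       trans (𝟙-yes (markedOccurrence? k (insertMarked y)) occ) (sym (𝟙-yes (markedArc? k y) marked))
        where
          marked = 𝟙≢0⇒ (markedArc? k y) ne
          occ = proj₁ (insertMarked-sound y marked)
          round-trip = proj₂ (insertMarked-sound y marked)

a-recurrence : ∀ n k → a (suc n) (suc k) * suc k ≡ a n k * n
a-recurrence n k = begin
  a (suc n) (suc k) * suc k                                   ≡⟨ cong (_* suc k) (a≡matchings (suc n) (suc k)) ⟩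
  matchings (2 * suc n) (suc k) * suc k                       ≡⟨ cong (λ M → matchings M (suc k) * suc k) (*-suc 2 n) ⟩
  matchings (2 + 2 * n) (suc k) * suc k                       ≡⟨ ∑-markedOccurrences (2 + 2 * n) k ⟨
  ∑[ x ∈ allPointed (2 + 2 * n) ] 𝟙 (markedOccurrence? k x)   ≡⟨ markedOccurrences≡markedArcs {2 * n} k ⟩
  ∑[ y ∈ allPointed (2 * n) ] 𝟙 (markedArc? k y)              ≡⟨ ∑-markedArcs n k ⟩
  matchings (2 * n) k * n                                     ≡⟨ cong (_* n) (a≡matchings n k) ⟨
  a n k * n                                                   ∎
  where open ≡-Reasoning

[k+1]*[n+1]C[k+1]≡[n+1]*nCk : ∀ n k → suc k * (suc n C suc k) ≡ suc n * (n C k)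
[k+1]*[n+1]C[k+1]≡[n+1]*nCk zero    zero    = refl
[k+1]*[n+1]C[k+1]≡[n+1]*nCk zero    (suc k) = *-zeroʳ (suc (suc k))
[k+1]*[n+1]C[k+1]≡[n+1]*nCk (suc m) zero    =
  trans (+-identityʳ _) (trans (nC1≡n (suc (suc m))) (sym (*-identityʳ (suc (suc m)))))
[k+1]*[n+1]C[k+1]≡[n+1]*nCk (suc m) (suc k) = begin
  suc (suc k) * (suc (suc m) C suc (suc k))
    ≡⟨ cong (suc (suc k) *_) (nCk+nC[k+1]≡[n+1]C[k+1] (suc m) (suc k)) ⟨
  suc (suc k) * (X + Y)
    ≡⟨ *-distribˡ-+ (suc (suc k)) X Y ⟩
  X + suc k * X + suc (suc k) * Y
    ≡⟨ cong₂ (λ x y → X + x + y) ([k+1]*[n+1]C[k+1]≡[n+1]*nCk m k) ([k+1]*[n+1]C[k+1]≡[n+1]*nCk m (suc k)) ⟩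
  X + suc m * (m C k) + suc m * (m C suc k)
    ≡⟨ +-assoc X _ _ ⟩
  X + (suc m * (m C k) + suc m * (m C suc k))
    ≡⟨ cong (X +_) (*-distribˡ-+ (suc m) (m C k) (m C suc k)) ⟨
  X + suc m * (m C k + m C suc k)
    ≡⟨ cong (λ x → X + suc m * x) (nCk+nC[k+1]≡[n+1]C[k+1] m k) ⟩
  suc (suc m) * X ∎
  where
    open ≡-Reasoning
    X = suc m C suc k
    Y = suc m C suc (suc k)

lemma2 : (n k : ℕ) → k < n → a n k ≡ ((n ∸ 1) C k) * a (n ∸ k) 0
lemma2 n       zero    _     = sym (*-identityˡ (a n 0))
lemma2 (suc n) (suc k) k<1+n = *-cancelʳ-≡ _ _ (suc k) (begin
  a (suc n) (suc k) * suc k               ≡⟨ a-recurrence n k ⟩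
  a n k * n                               ≡⟨ cong (_* n) (lemma2 n k (s≤s⁻¹ k<1+n)) ⟩
  ((n ∸ 1) C k) * a (n ∸ k) 0 * n         ≡⟨ absorb n (s≤s⁻¹ k<1+n) ⟩
  (n C suc k) * a (n ∸ k) 0 * suc k       ∎)
  where
    open ≡-Reasoning
    absorb : ∀ m → k < m → ((m ∸ 1) C k) * a (m ∸ k) 0 * m ≡ (m C suc k) * a (m ∸ k) 0 * suc k
    absorb (suc m) _ = begin
      (m C k) * a₀ * suc m            ≡⟨ *-CS.xy∙z≈zx∙y (m C k) a₀ (suc m) ⟩
      suc m * (m C k) * a₀            ≡⟨ cong (_* a₀) ([k+1]*[n+1]C[k+1]≡[n+1]*nCk m k) ⟨
      suc k * (suc m C suc k) * a₀    ≡⟨ *-CS.xy∙z≈yz∙x (suc k) (suc m C suc k) a₀ ⟩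
      (suc m C suc k) * a₀ * suc k    ∎
      where a₀ = a (suc m ∸ k) 0
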